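{- Let $T$ be a tree on $n \geq 4$ vertices which is a path, and let $l_1$ and $l_2$ be the numbers of vertices of $T$ of degree one and degree two, respectively. Then the procedure Path_Augmentation applied to $T$ adds exactly $\left\lceil \frac{2l_1+l_2}{2}\right\rceil$ edges, i.e. the returned set satisfies $|E_{ca}| = \left\lceil \frac{2l_1+l_2}{2}\right\rceil$.
   Context: Procedure Path_Augmentation: the input is a tree $T$ that is a path on $n$ vertices, written $v_1, v_2, \ldots, v_n$ with $v_i$ adjacent to $v_{i+1}$ for $1\le i\le n-1$. "Adding" an edge means inserting it into the current graph (initially $T$) and into the output set $E_{ca}$ (initially empty). First add the edge $\{v_1,v_n\}$. Then, for $i=1,2,\ldots,\lceil n/2\rceil$ in this order: if the current degree of $v_i$ equals 2, add the edge $\{v_i, v_{\lfloor n/2\rfloor + i}\}$. Finally, if the current degree of $v_n$ equals 2, add the edge $\{v_n, v_{\lfloor n/2\rfloor+1}\}$. The procedure returns the resulting graph $H$ and the set $E_{ca}$. -}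

module Defs where

open import Data.Nat using (ℕ; zero; suc; _+_; _∸_; _≟_; ⌊_/2⌋; ⌈_/2⌉)
open import Data.Nat.Base using (_≡ᵇ_)
open import Data.Bool using (Bool; true; false; if_then_else_)
open import Data.List using (List; []; _∷_; length; map; filter; foldl)
open import Data.Product using (_×_; _,_; proj₁; proj₂)

-- Vertices v_1..v_n are represented by the natural numbers 1..n.
-- An (undirected) edge {u,w} is represented by the pair (u , w).
Edge : Set
Edge = ℕ × ℕ

-- Graphs are edge lists (multigraphs) on vertex set {1..n}.
Graph : Set
Graph = List Edge

deg : Graph → ℕ → ℕ
deg [] v = 0
deg ((a , b) ∷ es) v =
  (if (a ≡ᵇ v) then 1 else (if (b ≡ᵇ v) then 1 else 0)) + deg es v

range : ℕ → ℕ → List ℕ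
range a zero = []
range a (suc k) = a ∷ range (suc a) k

vertices : ℕ → List ℕ
vertices n = range 1 n

pathTree : ℕ → Graph
pathTree n = map (λ i → (i , suc i)) (range 1 (n ∸ 1))

countDeg : ℕ → Graph → ℕ → ℕ
countDeg n G d = length (filter (λ v → deg G v ≟ d) (vertices n))

-- state of the procedure: (current graph H , added edges E_ca)
State : Set
State = Graph × List Edge

addEdge : Edge → State → State
addEdge e (H , E) = (e ∷ H , e ∷ E)

addIfDeg2 : ℕ → Edge → State → State
addIfDeg2 v e s = if deg (proj₁ s) v ≡ᵇ 2 then addEdge e s else s

pathAugmentation : ℕ → State
pathAugmentation n =
  let s0 = addEdge (1 , n) (pathTree n , [])
      s1 = foldl (λ s i → addIfDeg2 i (i , ⌊ n /2⌋ + i) s) s0 (range 1 ⌈ n /2⌉)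
  in addIfDeg2 n (n , ⌊ n /2⌋ + 1) s1

Eca : ℕ → List Edge
Eca n = proj₂ (pathAugmentation n)

-- Adding {v₁, vₙ} turns the path into the cycle Cₙ, in which every vertex has
-- degree 2, so from then on a vertex receives an edge exactly when no edge added
-- since is incident to it. With m = ⌊n/2⌋ the chord {vᵢ, v_{m+i}} of round i
-- ends beyond vₘ, hence rounds 1, …, m all add their chord. For even n the
-- chord {vₘ, vₙ} blocks the final step; for odd n the extra round m + 1 is
-- blocked by {v₁, v_{m+1}} while vₙ is untouched and gets its edge. Either way
-- 1 + ⌈n/2⌉ edges are added, and 2l₁ + l₂ = 4 + (n - 2) since l₁ = 2, l₂ = n - 2.
module Submission where

open import Defs
open import Data.Nat using (ℕ; zero; suc; _≤_; _<_; _+_; _*_; _∸_; ⌈_/2⌉; ⌊_/2⌋; z≤n; s≤s; z<s; _≡ᵇ_; _≟_)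
open import Data.Nat.Properties
open import Data.Bool using (true; false)
open import Data.List using (List; []; _∷_; _∷ʳ_; _++_; length; map; filter; foldl)
open import Data.List.Properties using (filter-accept; filter-reject; filter-all; filter-none; filter-++; length-++; length-map; map-++; foldl-∷ʳ)
open import Data.List.Relation.Unary.All as All using (All; []; _∷_)
open import Data.Product using (_,_; proj₁; proj₂)
open import Data.Sum using (_⊎_; inj₁; inj₂)
open import Function using (_∘_)
open import Relation.Nullary using (contradiction)
open import Relation.Unary using (Decidable)
open import Relation.Binary.PropositionalEquality
open import Algebra.Properties.CommutativeSemigroup +-commutativeSemigroup using (x∙yz≈y∙xz)

deg-∷-miss : ∀ {v} a b es → a ≢ v → b ≢ v → deg ((a , b) ∷ es) v ≡ deg es v
deg-∷-miss {v} a b es a≢v b≢v with a ≡ᵇ v | ≡ᵇ⇒≡ a v | b ≡ᵇ v | ≡ᵇ⇒≡ b v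
... | true  | a≡v | _     | _   = contradiction (a≡v _) a≢v
... | false | _   | true  | b≡v = contradiction (b≡v _) b≢v
... | false | _   | false | _   = refl

deg-∷-hitˡ : ∀ {v} a b es → a ≡ v → deg ((a , b) ∷ es) v ≡ suc (deg es v)
deg-∷-hitˡ {v} a b es a≡v with a ≡ᵇ v | ≡⇒≡ᵇ a v a≡v
... | true | _ = refl

deg-∷-hitʳ : ∀ {v} a b es → b ≡ v → deg ((a , b) ∷ es) v ≡ suc (deg es v)
deg-∷-hitʳ {v} a b es b≡v with a ≡ᵇ v | b ≡ᵇ v | ≡⇒≡ᵇ b v b≡v
... | true  | _    | _ = refl
... | false | true | _ = refl

deg-∷ : ∀ e es v → deg (e ∷ es) v ≡ deg (e ∷ []) v + deg es v
deg-∷ e es v = sym (+-assoc _ 0 (deg es v))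

deg-∷-≥ : ∀ e es v → deg es v ≤ deg (e ∷ es) v
deg-∷-≥ e es v = m≤n+m (deg es v) _

range-∷ʳ : ∀ a k → range a (suc k) ≡ range a k ∷ʳ (a + k)
range-∷ʳ a zero    = cong (_∷ []) (sym (+-identityʳ a))
range-∷ʳ a (suc k) = cong (a ∷_) (trans (range-∷ʳ (suc a) k) (cong (range (suc a) k ∷ʳ_) (sym (+-suc a k))))

length-range : ∀ a k → length (range a k) ≡ k
length-range a zero    = refl
length-range a (suc k) = cong suc (length-range (suc a) k)

All-range : ∀ {P : ℕ → Set} a k → (∀ v → a ≤ v → v < a + k → P v) → All P (range a k)
All-range a zero    p = []
All-range a (suc k) p =
  p a ≤-refl (m<m+n a z<s) ∷
  All-range (suc a) k (λ v a<v v<a+k → p v (<⇒≤ a<v) (subst (v <_) (sym (+-suc a k)) v<a+k))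

length-filter-++ : ∀ {A : Set} {P : A → Set} (P? : Decidable P) xs ys →
  length (filter P? (xs ++ ys)) ≡ length (filter P? xs) + length (filter P? ys)
length-filter-++ P? xs ys = trans (cong length (filter-++ P? xs ys)) (length-++ (filter P? xs))

-- pathTree n is definitionally chords 1 1 (n ∸ 1).
chords : ℕ → ℕ → ℕ → List Edge
chords d a k = map (λ i → (i , d + i)) (range a k)

chords-∷ʳ : ∀ d a k → chords d a (suc k) ≡ chords d a k ∷ʳ (a + k , d + (a + k))
chords-∷ʳ d a k = trans (cong (map _) (range-∷ʳ a k)) (map-++ _ (range a k) _)

length-chords : ∀ d a k → length (chords d a k) ≡ k
length-chords d a k = trans (length-map _ (range a k)) (length-range a k)

deg-chords-below : ∀ d a k {v} → v < a → deg (chords d a k) v ≡ 0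
deg-chords-below d a zero    v<a = refl
deg-chords-below d a (suc k) v<a =
  trans (deg-∷-miss a (d + a) (chords d (suc a) k) (>⇒≢ v<a) (>⇒≢ (<-≤-trans v<a (m≤n+m a d))))
        (deg-chords-below d (suc a) k (m<n⇒m<1+n v<a))

deg-chords-beyond : ∀ d a k {v} → a + k ≤ v → v < d + a ⊎ d + (a + k) ≤ v → deg (chords d a k) v ≡ 0
deg-chords-beyond d a zero    _     _ = refl
deg-chords-beyond d a (suc k) {v} a+k≤v far =
  trans (deg-∷-miss a (d + a) (chords d (suc a) k) (<⇒≢ (<-≤-trans (m<m+n a z<s) a+k≤v)) (far⇒≢ far))
        (deg-chords-beyond d (suc a) k (subst (_≤ v) (+-suc a k) a+k≤v) (far-step far))
  where
  far⇒≢ : v < d + a ⊎ d + (a + suc k) ≤ v → d + a ≢ v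
  far⇒≢ (inj₁ v<d+a) = >⇒≢ v<d+a
  far⇒≢ (inj₂ ≤v)    = <⇒≢ (<-≤-trans (+-monoʳ-< d (m<m+n a z<s)) ≤v)
  far-step : v < d + a ⊎ d + (a + suc k) ≤ v → v < d + suc a ⊎ d + (suc a + k) ≤ v
  far-step (inj₁ v<d+a) = inj₁ (<-trans v<d+a (+-monoʳ-< d (n<1+n a)))
  far-step (inj₂ ≤v)    = inj₂ (subst (λ x → d + x ≤ v) (+-suc a k) ≤v)

deg-chords-target : ∀ d a k {i} → a ≤ i → i < a + k → 1 ≤ deg (chords d a k) (d + i)
deg-chords-target d a zero    {i} a≤i i<a+0 = contradiction a≤i (<⇒≱ (subst (i <_) (+-identityʳ a) i<a+0))
deg-chords-target d a (suc k) {i} a≤i i<a+k   with m≤n⇒m<n∨m≡n a≤i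
... | inj₂ refl = ≤-trans (s≤s z≤n) (≤-reflexive (sym (deg-∷-hitʳ a (d + a) (chords d (suc a) k) refl)))
... | inj₁ a<i  = ≤-trans (deg-chords-target d (suc a) k a<i (subst (i <_) (+-suc a k) i<a+k))
                          (deg-∷-≥ (a , d + a) (chords d (suc a) k) (d + i))

deg-path-start : ∀ a k → deg (chords 1 a (suc k)) a ≡ 1
deg-path-start a k =
  trans (deg-∷-hitˡ a (suc a) (chords 1 (suc a) k) refl) (cong suc (deg-chords-below 1 (suc a) k (n<1+n a)))

deg-path-end : ∀ a k → deg (chords 1 a (suc k)) (suc (a + k)) ≡ 1
deg-path-end a zero    = deg-∷-hitʳ a (suc a) [] (cong suc (sym (+-identityʳ a)))
deg-path-end a (suc k) rewrite +-suc a k =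
  trans (deg-∷-miss a (suc a) (chords 1 (suc a) (suc k))
                    (<⇒≢ (m<n⇒m<1+n (s≤s (m≤m+n a k)))) (<⇒≢ (s≤s (s≤s (m≤m+n a k)))))
        (deg-path-end (suc a) k)

deg-path-inner : ∀ a k {v} → a < v → v < a + k → deg (chords 1 a k) v ≡ 2
deg-path-inner a zero    a<v v<a+0 = contradiction (<-trans a<v v<a+0) (<-irrefl (sym (+-identityʳ a)))
deg-path-inner a (suc k) {v} a<v v<a+k with m≤n⇒m<n∨m≡n a<v
... | inj₁ 1+a<v =
  trans (deg-∷-miss a (suc a) (chords 1 (suc a) k) (<⇒≢ a<v) (<⇒≢ 1+a<v))
        (deg-path-inner (suc a) k 1+a<v (subst (v <_) (+-suc a k) v<a+k))
... | inj₂ refl with k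
...   | zero   = contradiction v<a+k (<-irrefl (sym (+-comm a 1)))
...   | suc k′ =
  trans (deg-∷-hitʳ a (suc a) (chords 1 (suc a) (suc k′)) refl) (cong suc (deg-path-start (suc a) k′))

deg-cycle : ∀ {n v} → 2 ≤ n → 1 ≤ v → v ≤ n → deg ((1 , n) ∷ pathTree n) v ≡ 2
deg-cycle {suc zero}    {_}           (s≤s ()) _ _
deg-cycle {suc (suc k)} {suc zero}    _        _ _   = cong suc (deg-path-start 1 k)
deg-cycle {suc (suc k)} {suc (suc v)} _        _ v≤n with m≤n⇒m<n∨m≡n v≤n
... | inj₁ v<n  = trans (deg-∷-miss 1 (suc (suc k)) (pathTree (suc (suc k))) (λ ()) (>⇒≢ v<n))
                      (deg-path-inner 1 (suc k) (s≤s (s≤s z≤n)) v<n)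
... | inj₂ refl = trans (deg-∷-hitʳ 1 (suc (suc k)) (pathTree (suc (suc k))) refl)
                      (cong suc (deg-path-end 1 k))

initialState : ℕ → State
initialState n = addEdge (1 , n) (pathTree n , [])

addEdges : List Edge → State → State
addEdges es s = foldl (λ s e → addEdge e s) s es

length-addEdges : ∀ es s → length (proj₂ (addEdges es s)) ≡ length es + length (proj₂ s)
length-addEdges []       s = refl
length-addEdges (e ∷ es) s = trans (length-addEdges es (addEdge e s)) (+-suc (length es) _)

deg-addEdges : ∀ es s v → deg (proj₁ (addEdges es s)) v ≡ deg es v + deg (proj₁ s) v
deg-addEdges []       s v = refl
deg-addEdges (e ∷ es) (H , E) v = begin
  deg (proj₁ (addEdges es (addEdge e (H , E)))) v ≡⟨ deg-addEdges es (addEdge e (H , E)) v ⟩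
  deg es v + deg (e ∷ H) v                      ≡⟨ cong (deg es v +_) (deg-∷ e H v) ⟩
  deg es v + (deg (e ∷ []) v + deg H v)         ≡⟨ x∙yz≈y∙xz (deg es v) (deg (e ∷ []) v) (deg H v) ⟩
  deg (e ∷ []) v + (deg es v + deg H v)         ≡⟨ sym (+-assoc (deg (e ∷ []) v) (deg es v) (deg H v)) ⟩
  deg (e ∷ []) v + deg es v + deg H v           ≡⟨ cong (_+ deg H v) (sym (deg-∷ e es v)) ⟩
  deg (e ∷ es) v + deg H v                      ∎
  where open ≡-Reasoning

addIfDeg2-deg≡2 : ∀ v e s → deg (proj₁ s) v ≡ 2 → addIfDeg2 v e s ≡ addEdge e s
addIfDeg2-deg≡2 v e s deg≡2 rewrite deg≡2 = refl

addIfDeg2-deg≢2 : ∀ v e s → deg (proj₁ s) v ≢ 2 → addIfDeg2 v e s ≡ s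
addIfDeg2-deg≢2 v e s deg≢2 with deg (proj₁ s) v ≡ᵇ 2 | ≡ᵇ⇒≡ (deg (proj₁ s) v) 2
... | true  | deg≡2 = contradiction (deg≡2 _) deg≢2
... | false | _     = refl

module _ {n} (2≤n : 2 ≤ n) (es : List Edge) {v} (1≤v : 1 ≤ v) (v≤n : v ≤ n) where

  deg-addEdges-initialState : deg (proj₁ (addEdges es (initialState n))) v ≡ deg es v + 2
  deg-addEdges-initialState =
    trans (deg-addEdges es (initialState n) v) (cong (deg es v +_) (deg-cycle 2≤n 1≤v v≤n))

  addIfDeg2-untouched : ∀ e → deg es v ≡ 0 →
    addIfDeg2 v e (addEdges es (initialState n)) ≡ addEdge e (addEdges es (initialState n))
  addIfDeg2-untouched e untouched =
    addIfDeg2-deg≡2 v e _ (trans deg-addEdges-initialState (cong (_+ 2) untouched))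

  addIfDeg2-touched : ∀ e → 1 ≤ deg es v →
    addIfDeg2 v e (addEdges es (initialState n)) ≡ addEdges es (initialState n)
  addIfDeg2-touched e touched =
    addIfDeg2-deg≢2 v e _ (>⇒≢ (subst (2 <_) (sym deg-addEdges-initialState) (+-monoˡ-≤ 2 touched)))

chordStep : ℕ → State → ℕ → State
chordStep m s i = addIfDeg2 i (i , m + i) s

chordRounds : ∀ {n m} → 2 ≤ n → m ≤ n → ∀ k → k ≤ m →
  foldl (chordStep m) (initialState n) (range 1 k) ≡ addEdges (chords m 1 k) (initialState n)
chordRounds                 2≤n m≤n zero    _   = refl
chordRounds {n = n} {m = m} 2≤n m≤n (suc k) k<m = begin
  foldl (chordStep m) s₀ (range 1 (suc k))         ≡⟨ cong (foldl (chordStep m) s₀) (range-∷ʳ 1 k) ⟩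
  foldl (chordStep m) s₀ (range 1 k ∷ʳ suc k)      ≡⟨ foldl-∷ʳ (chordStep m) s₀ (suc k) (range 1 k) ⟩
  chordStep m (foldl (chordStep m) s₀ (range 1 k)) (suc k)
    ≡⟨ cong (λ s → chordStep m s (suc k)) (chordRounds 2≤n m≤n k (<⇒≤ k<m)) ⟩
  chordStep m (addEdges (chords m 1 k) s₀) (suc k)
    ≡⟨ addIfDeg2-untouched 2≤n (chords m 1 k) (s≤s z≤n) (≤-trans k<m m≤n) _
         (deg-chords-beyond m 1 k ≤-refl (inj₁ (subst (suc k <_) (+-comm 1 m) (s≤s k<m)))) ⟩
  addEdge (suc k , m + suc k) (addEdges (chords m 1 k) s₀)
    ≡⟨ sym (foldl-∷ʳ _ s₀ _ (chords m 1 k)) ⟩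
  addEdges (chords m 1 k ∷ʳ (suc k , m + suc k)) s₀ ≡⟨ cong (λ es → addEdges es s₀) (sym (chords-∷ʳ m 1 k)) ⟩
  addEdges (chords m 1 (suc k)) s₀                 ∎
  where
  open ≡-Reasoning
  s₀ = initialState n

-- Eca n is definitionally proj₂ (augmentWith n ⌊ n /2⌋ ⌈ n /2⌉).
augmentWith : ℕ → ℕ → ℕ → State
augmentWith n m c = addIfDeg2 n (n , m + 1) (foldl (chordStep m) (initialState n) (range 1 c))

length-augmentWith-even : ∀ m → 1 ≤ m → length (proj₂ (augmentWith (m + m) m m)) ≡ suc m
length-augmentWith-even m 1≤m = begin
  length (proj₂ (addIfDeg2 n (n , m + 1) (foldl (chordStep m) s₀ (range 1 m))))
    ≡⟨ cong (λ s → length (proj₂ (addIfDeg2 n (n , m + 1) s))) (chordRounds 2≤n m≤n m ≤-refl) ⟩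
  length (proj₂ (addIfDeg2 n (n , m + 1) (addEdges (chords m 1 m) s₀)))
    ≡⟨ cong (length ∘ proj₂) (addIfDeg2-touched 2≤n (chords m 1 m) (≤-trans 1≤m m≤n) ≤-refl _
                                (deg-chords-target m 1 m 1≤m (n<1+n m))) ⟩
  length (proj₂ (addEdges (chords m 1 m) s₀)) ≡⟨ length-addEdges (chords m 1 m) s₀ ⟩
  length (chords m 1 m) + 1                   ≡⟨ cong (_+ 1) (length-chords m 1 m) ⟩
  m + 1                                       ≡⟨ +-comm m 1 ⟩
  suc m                                       ∎
  where
  open ≡-Reasoning
  n = m + m
  s₀ = initialState n
  2≤n : 2 ≤ n
  2≤n = +-mono-≤ 1≤m 1≤m
  m≤n : m ≤ n
  m≤n = m≤m+n m m

length-augmentWith-odd : ∀ m → 1 ≤ m → length (proj₂ (augmentWith (suc (m + m)) m (suc m))) ≡ suc (suc m)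
length-augmentWith-odd m 1≤m = begin
  length (proj₂ (addIfDeg2 n (n , m + 1) (foldl (chordStep m) s₀ (range 1 (suc m)))))
    ≡⟨ cong (λ s → length (proj₂ (addIfDeg2 n (n , m + 1) s))) rounds ⟩
  length (proj₂ (addIfDeg2 n (n , m + 1) (addEdges (chords m 1 m) s₀)))
    ≡⟨ cong (length ∘ proj₂) (addIfDeg2-untouched 2≤n (chords m 1 m) (s≤s z≤n) ≤-refl _
                                (deg-chords-beyond m 1 m (s≤s m≤n) (inj₂ (≤-reflexive (+-suc m m))))) ⟩
  suc (length (proj₂ (addEdges (chords m 1 m) s₀))) ≡⟨ cong suc (length-addEdges (chords m 1 m) s₀) ⟩
  suc (length (chords m 1 m) + 1)                   ≡⟨ cong (λ k → suc (k + 1)) (length-chords m 1 m) ⟩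
  suc (m + 1)                                       ≡⟨ cong suc (+-comm m 1) ⟩
  suc (suc m)                                       ∎
  where
  open ≡-Reasoning
  n = suc (m + m)
  s₀ = initialState n
  m≤n : m ≤ m + m
  m≤n = m≤m+n m m
  2≤n : 2 ≤ n
  2≤n = s≤s (≤-trans 1≤m m≤n)
  touched-mid : 1 ≤ deg (chords m 1 m) (suc m)
  touched-mid =
    subst (λ v → 1 ≤ deg (chords m 1 m) v) (+-comm m 1) (deg-chords-target m 1 m ≤-refl (s≤s 1≤m))
  rounds : foldl (chordStep m) s₀ (range 1 (suc m)) ≡ addEdges (chords m 1 m) s₀
  rounds = begin
    foldl (chordStep m) s₀ (range 1 (suc m))                ≡⟨ cong (foldl (chordStep m) s₀) (range-∷ʳ 1 m) ⟩
    foldl (chordStep m) s₀ (range 1 m ∷ʳ suc m)             ≡⟨ foldl-∷ʳ (chordStep m) s₀ (suc m) (range 1 m) ⟩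
    chordStep m (foldl (chordStep m) s₀ (range 1 m)) (suc m)
      ≡⟨ cong (λ s → chordStep m s (suc m)) (chordRounds 2≤n (m≤n⇒m≤1+n m≤n) m ≤-refl) ⟩
    chordStep m (addEdges (chords m 1 m) s₀) (suc m)
      ≡⟨ addIfDeg2-touched 2≤n (chords m 1 m) (s≤s z≤n) (s≤s m≤n) _ touched-mid ⟩
    addEdges (chords m 1 m) s₀                              ∎

data Parity : ℕ → Set where
  even : ∀ m → Parity (m + m)
  odd  : ∀ m → Parity (suc (m + m))

parity : ∀ n → Parity n
parity zero          = even zero
parity (suc zero)    = odd zero
parity (suc (suc n)) with parity n
... | even m = subst Parity (cong suc (+-suc m m)) (even (suc m))
... | odd m  = subst Parity (cong (suc ∘ suc) (+-suc m m)) (odd (suc m))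

length-Eca : ∀ {n} → 2 ≤ n → length (Eca n) ≡ suc ⌈ n /2⌉
length-Eca {n} 2≤n with parity n
... | even zero    = contradiction 2≤n λ ()
... | odd zero     = contradiction 2≤n λ { (s≤s ()) }
... | even m@(suc _) = begin
  length (proj₂ (augmentWith (m + m) ⌊ m + m /2⌋ ⌈ m + m /2⌉))
    ≡⟨ cong₂ (λ m′ c → length (proj₂ (augmentWith (m + m) m′ c)))
             (sym (n≡⌊n+n/2⌋ m)) (sym (n≡⌈n+n/2⌉ m)) ⟩
  length (proj₂ (augmentWith (m + m) m m)) ≡⟨ length-augmentWith-even m (s≤s z≤n) ⟩
  suc m                                    ≡⟨ cong suc (n≡⌈n+n/2⌉ m) ⟩
  suc ⌈ m + m /2⌉                          ∎
  where open ≡-Reasoning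
... | odd m@(suc _) = begin
  length (proj₂ (augmentWith (suc (m + m)) ⌈ m + m /2⌉ (suc ⌊ m + m /2⌋)))
    ≡⟨ cong₂ (λ m′ c → length (proj₂ (augmentWith (suc (m + m)) m′ c)))
             (sym (n≡⌈n+n/2⌉ m)) (cong suc (sym (n≡⌊n+n/2⌋ m))) ⟩
  length (proj₂ (augmentWith (suc (m + m)) m (suc m))) ≡⟨ length-augmentWith-odd m (s≤s z≤n) ⟩
  suc (suc m)                                          ≡⟨ cong (suc ∘ suc) (n≡⌊n+n/2⌋ m) ⟩
  suc (suc ⌊ m + m /2⌋)                                ∎
  where open ≡-Reasoning

vertices-split : ∀ k → vertices (suc (suc k)) ≡ (1 ∷ []) ++ range 2 k ++ (suc (suc k) ∷ [])
vertices-split k = cong (1 ∷_) (range-∷ʳ 2 k)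

deg-path-inner-All : ∀ k → All (λ v → deg (pathTree (suc (suc k))) v ≡ 2) (range 2 k)
deg-path-inner-All k = All-range 2 k (λ v 2≤v v<2+k → deg-path-inner 1 (suc k) 2≤v v<2+k)

countDeg-path-split : ∀ k d → let Q = λ v → deg (pathTree (suc (suc k))) v ≟ d in
  countDeg (suc (suc k)) (pathTree (suc (suc k))) d ≡
    length (filter Q (1 ∷ [])) + (length (filter Q (range 2 k)) + length (filter Q (suc (suc k) ∷ [])))
countDeg-path-split k d = trans (cong (length ∘ filter Q) (vertices-split k))
  (trans (length-filter-++ Q (1 ∷ []) _) (cong (length (filter Q (1 ∷ [])) +_) (length-filter-++ Q (range 2 k) _)))
  where Q = λ v → deg (pathTree (suc (suc k))) v ≟ d

countDeg-path-leaves : ∀ {n} → 2 ≤ n → countDeg n (pathTree n) 1 ≡ 2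
countDeg-path-leaves {suc zero}    (s≤s ())
countDeg-path-leaves {suc (suc k)} _ =
  trans (countDeg-path-split k 1) (cong₂ _+_ first (cong₂ _+_ inner last))
  where
  Q = λ v → deg (pathTree (suc (suc k))) v ≟ 1
  first : length (filter Q (1 ∷ [])) ≡ 1
  first = cong length (filter-accept Q {1} {[]} (deg-path-start 1 k))
  inner : length (filter Q (range 2 k)) ≡ 0
  inner = cong length (filter-none Q (All.map (λ deg≡2 deg≡1 → contradiction (trans (sym deg≡2) deg≡1) λ ())
                                              (deg-path-inner-All k)))
  last : length (filter Q (suc (suc k) ∷ [])) ≡ 1
  last = cong length (filter-accept Q {suc (suc k)} {[]} (deg-path-end 1 k))

countDeg-path-inner : ∀ {n} → 2 ≤ n → countDeg n (pathTree n) 2 ≡ n ∸ 2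
countDeg-path-inner {suc zero}    (s≤s ())
countDeg-path-inner {suc (suc k)} _ =
  trans (countDeg-path-split k 2) (trans (cong₂ _+_ first (cong₂ _+_ inner last)) (+-identityʳ k))
  where
  Q = λ v → deg (pathTree (suc (suc k))) v ≟ 2
  first : length (filter Q (1 ∷ [])) ≡ 0
  first = cong length (filter-reject Q {1} {[]} (λ deg≡2 → contradiction (trans (sym (deg-path-start 1 k)) deg≡2) λ ()))
  inner : length (filter Q (range 2 k)) ≡ k
  inner = trans (cong length (filter-all Q (deg-path-inner-All k))) (length-range 2 k)
  last : length (filter Q (suc (suc k) ∷ [])) ≡ 0
  last = cong length (filter-reject Q {suc (suc k)} {[]} (λ deg≡2 → contradiction (trans (sym (deg-path-end 1 k)) deg≡2) λ ()))

lemma4 : (n : ℕ) → 4 ≤ n →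
    length (Eca n) ≡ ⌈ (2 * countDeg n (pathTree n) 1 + countDeg n (pathTree n) 2) /2⌉
lemma4 n 4≤n = begin
  length (Eca n)              ≡⟨ length-Eca 2≤n ⟩
  suc ⌈ n /2⌉                 ≡⟨ cong (λ k → suc ⌈ k /2⌉) (sym (m+[n∸m]≡n 2≤n)) ⟩
  ⌈ (2 * 2 + (n ∸ 2)) /2⌉
    ≡⟨ cong₂ (λ l₁ l₂ → ⌈ (2 * l₁ + l₂) /2⌉) (sym (countDeg-path-leaves 2≤n)) (sym (countDeg-path-inner 2≤n)) ⟩
  ⌈ (2 * countDeg n (pathTree n) 1 + countDeg n (pathTree n) 2) /2⌉ ∎
  where
  open ≡-Reasoning
  2≤n : 2 ≤ n
  2≤n = ≤-trans (s≤s (s≤s z≤n)) 4≤n
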